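{- For every base $\mathcal{B} \supseteq \mathcal{N}$ and every proposition $\phi$ over $\mathrm{At}$: $\mathcal{B} \in [\![\phi^\flat]\!]$ (equivalently $\mathcal{B} \in [\![\phi^\flat]\!]_J$) if and only if $\mathcal{B} \in [\![\phi]\!]_J$.
   Context: Fix a countably infinite set $\mathrm{At}$ of atoms; propositions over $\mathrm{At}$ are built from atoms, $\top$, $\bot$ using $\wedge, \vee, \supset$. For every non-atomic proposition $\phi$ over $\mathrm{At}$ introduce a fresh atom $\phi^\flat$, and for $a \in \mathrm{At}$ put $a^\flat = a$; let $\mathrm{At}^* = \{\phi^\flat \mid \phi \text{ a proposition over } \mathrm{At}\}$, and for a set $\Gamma$ of propositions, $\Gamma^\flat = \{\gamma^\flat \mid \gamma \in \Gamma\}$. An atomic rule (over $\mathrm{At}^*$) has the form $((P_1 \Rightarrow a_1), \dots, (P_n \Rightarrow a_n) \Rightarrow b)$ with $n \ge 0$, atoms $a_i, b \in \mathrm{At}^*$ and finite sets $P_i \subseteq \mathrm{At}^*$. A base is a set of atomic rules; $\mathcal{W}$ is the set of all bases, ordered by inclusion. Derivability $P \vdash_{\mathcal{B}} a$ is defined inductively by (Ref) $P, a \vdash_{\mathcal{B}} a$ and (App) for a rule $((P_1 \Rightarrow a_1),\dots,(P_n \Rightarrow a_n) \Rightarrow b) \in \mathcal{B}$ and finite $Q$, if $Q, P_i \vdash_{\mathcal{B}} a_i$ for all $i$ then $Q \vdash_{\mathcal{B}} b$ (commas denote union). The base $\mathcal{N}$ consists of, for every instance of a rule of intuitionistic natural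 deduction NJ with premises $\psi_1,\dots,\psi_n$ (where $\Gamma_i$ is the set of hypotheses discharged in the $i$-th premise) and conclusion $\chi$, the atomic rule $((\Gamma_1^\flat \Rightarrow \psi_1^\flat),\dots,(\Gamma_n^\flat \Rightarrow \psi_n^\flat) \Rightarrow \chi^\flat)$. Let $\mathcal{W}^\uparrow$ be the complete Heyting algebra of upward-closed subsets of $\mathcal{W}$ (meets of nonempty families are intersections, joins unions, $U \to V = \{\mathcal{B} \mid \forall \mathcal{C} \supseteq \mathcal{B},\ \mathcal{C} \in U \Rightarrow \mathcal{C} \in V\}$). For $a \in \mathrm{At}^*$ let $[\![a]\!] = \{\mathcal{B} \mid \emptyset \vdash_{\mathcal{B}} a\}$. Define $J(U) = \bigwedge_{b \in \mathrm{At}^*} ((U \to [\![b]\!]) \to [\![b]\!])$. The $J$-interpretation of propositions over $\mathrm{At}^*$: $[\![a]\!]_J = J([\![a]\!])$; $[\![\top]\!]_J = \mathcal{W}$; $[\![\phi \wedge \psi]\!]_J = [\![\phi]\!]_J \cap [\![\psi]\!]_J$; $[\![\phi \supset \psi]\!]_J = [\![\phi]\!]_J \to [\![\psi]\!]_J$; $[\![\bot]\!]_J = J(\emptyset)$; $[\![\phi \vee \psi]\!]_J = J([\![\phi]\!]_J \cup [\![\psi]\!]_J)$. -}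

module Defs where

open import Level using (Level; Lift; lift; 0ℓ) renaming (suc to lsuc)
open import Data.Nat using (ℕ)
open import Data.List using (List; []; _∷_; _++_)
open import Data.List.Membership.Propositional using (_∈_)
open import Data.List.Relation.Unary.All using (All)
open import Data.Product using (_×_; _,_)
open import Data.Sum using (_⊎_)

infixr 6 _∧'_
infixr 5 _∨'_
infixr 4 _⊃'_

data Form (A : Set) : Set where
  atom  : A → Form A
  ⊤'    : Form A
  ⊥'    : Form A
  _∧'_  : Form A → Form A → Form A
  _∨'_  : Form A → Form A → Form A
  _⊃'_  : Form A → Form A → Form A

mapForm : {A B : Set} → (A → B) → Form A → Form B
mapForm f (atom a) = atom (f a)
mapForm f ⊤' = ⊤'
mapForm f ⊥' = ⊥'
mapForm f (φ ∧' ψ) = mapForm f φ ∧' mapForm f ψ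
mapForm f (φ ∨' ψ) = mapForm f φ ∨' mapForm f ψ
mapForm f (φ ⊃' ψ) = mapForm f φ ⊃' mapForm f ψ

At : Set
At = ℕ

Prop : Set
Prop = Form At

-- At* = { φ♭ | φ a proposition over At }: one atom per proposition over At,
-- where (atom a)♭ is the atom a itself and φ♭ is a fresh atom otherwise.
record At* : Set where
  constructor _♭
  field unflat : Prop
open At* public

ι : Prop → Form At*
ι = mapForm (λ a → atom a ♭)

-- ((P₁ ⇒ a₁), …, (Pₙ ⇒ aₙ) ⇒ b); finite sets are represented by lists
record Rule : Set where
  constructor _⇒_
  field
    premises   : List (List At* × At*)
    conclusion : At*
open Rule public

Base : Set₁
Base = Rule → Set

_⊆B_ : Base → Base → Set
B ⊆B C = ∀ r → B r → C r

data Derives (B : Base) : List At* → At* → Set where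
  ref : ∀ {P a} → a ∈ P → Derives B P a
  app : ∀ {Q} (r : Rule) → B r →
        All (λ pa → Derives B (Q ++ Data.Product.proj₁ pa) (Data.Product.proj₂ pa))
            (premises r) →
        Derives B Q (conclusion r)

data 𝒩 : Rule → Set where
  ⊤I  : 𝒩 ([] ⇒ (⊤' ♭))
  ∧I  : ∀ φ ψ → 𝒩 ((([] , φ ♭) ∷ ([] , ψ ♭) ∷ []) ⇒ ((φ ∧' ψ) ♭))
  ∧E₁ : ∀ φ ψ → 𝒩 ((([] , (φ ∧' ψ) ♭) ∷ []) ⇒ (φ ♭))
  ∧E₂ : ∀ φ ψ → 𝒩 ((([] , (φ ∧' ψ) ♭) ∷ []) ⇒ (ψ ♭))
  ∨I₁ : ∀ φ ψ → 𝒩 ((([] , φ ♭) ∷ []) ⇒ ((φ ∨' ψ) ♭))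
  ∨I₂ : ∀ φ ψ → 𝒩 ((([] , ψ ♭) ∷ []) ⇒ ((φ ∨' ψ) ♭))
  ∨E  : ∀ φ ψ χ → 𝒩 ((([] , (φ ∨' ψ) ♭) ∷ ((φ ♭ ∷ []) , χ ♭) ∷ ((ψ ♭ ∷ []) , χ ♭) ∷ [])
                      ⇒ (χ ♭))
  ⊃I  : ∀ φ ψ → 𝒩 ((((φ ♭ ∷ []) , ψ ♭) ∷ []) ⇒ ((φ ⊃' ψ) ♭))
  ⊃E  : ∀ φ ψ → 𝒩 ((([] , (φ ⊃' ψ) ♭) ∷ ([] , φ ♭) ∷ []) ⇒ (ψ ♭))
  ⊥E  : ∀ φ → 𝒩 ((([] , ⊥' ♭) ∷ []) ⇒ (φ ♭))

-- Upward-closed subsets of 𝒲 (represented as predicates on bases;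
-- every predicate constructed below is upward closed)

UPred : Set₂
UPred = Base → Set₁

_∩_ : UPred → UPred → UPred
(U ∩ V) B = U B × V B

_∪_ : UPred → UPred → UPred
(U ∪ V) B = U B ⊎ V B

_⟶_ : UPred → UPred → UPred
(U ⟶ V) B = ∀ C → B ⊆B C → U C → V C

𝒲 : UPred
𝒲 B = Lift (lsuc 0ℓ) Data.Unit.⊤
  where import Data.Unit

∅ : UPred
∅ B = Lift (lsuc 0ℓ) Data.Empty.⊥
  where import Data.Empty

⟦_⟧ : At* → UPred
⟦ a ⟧ B = Lift (lsuc 0ℓ) (Derives B [] a)

J : UPred → UPred
J U B = ∀ b → ((U ⟶ ⟦ b ⟧) ⟶ ⟦ b ⟧) B

⟦_⟧J : Form At* → UPred
⟦ atom a ⟧J = J ⟦ a ⟧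
⟦ ⊤' ⟧J = 𝒲
⟦ ⊥' ⟧J = J ∅
⟦ φ ∧' ψ ⟧J = ⟦ φ ⟧J ∩ ⟦ ψ ⟧J
⟦ φ ∨' ψ ⟧J = J (⟦ φ ⟧J ∪ ⟦ ψ ⟧J)
⟦ φ ⊃' ψ ⟧J = ⟦ φ ⟧J ⟶ ⟦ ψ ⟧J

{-# OPTIONS --safe #-}
-- The rules of 𝒩
-- contained in B give the introduction and elimination steps; the J-clauses for
-- ⊥ and ∨ quantify over all atoms b, which is exactly what ⊥E and ∨E need.
-- A hypothesis φ♭ is simulated by adding the axiom (⇒ φ♭) to the base, and
-- discharged again by a deduction theorem for bases. The second equivalence
-- follows because J ⟦ a ⟧ = ⟦ a ⟧ for every atom a.
module Submission where

open import Defs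
open import Data.Product using (_×_; _,_; proj₁; proj₂)
open import Function.Bundles using (_⇔_; mk⇔)
open import Function.Construct.Composition using (_⇔-∘_)
open import Level using (lift; lower)
open import Data.List using (List; []; _∷_; _++_)
open import Data.List.Relation.Unary.All using (All; []; _∷_)
open import Data.List.Relation.Unary.Any using (here; there)
open import Data.Sum using (_⊎_; inj₁; inj₂)
open import Relation.Binary.PropositionalEquality using (_≡_; refl)

⊆B-refl : ∀ {B} → B ⊆B B
⊆B-refl r x = x

⊆B-trans : ∀ {A B C} → A ⊆B B → B ⊆B C → A ⊆B C
⊆B-trans s t r x = t r (s r x)

Premises : Base → List At* → List (List At* × At*) → Set
Premises B Q = All (λ pa → Derives B (Q ++ proj₁ pa) (proj₂ pa))

mutual
  derives-mono : ∀ {B C P a} → B ⊆B C → Derives B P a → Derives C P a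
  derives-mono s (ref a∈P) = ref a∈P
  derives-mono s (app r r∈B ds) = app r (s r r∈B) (premises-mono s ds)

  premises-mono : ∀ {B C Q ps} → B ⊆B C → Premises B Q ps → Premises C Q ps
  premises-mono s [] = []
  premises-mono s (d ∷ ds) = derives-mono s d ∷ premises-mono s ds

UpClosed : UPred → Set₁
UpClosed U = ∀ {B C} → B ⊆B C → U B → U C

⟦⟧-upClosed : ∀ a → UpClosed ⟦ a ⟧
⟦⟧-upClosed a s (lift d) = lift (derives-mono s d)

_+axiom_ : Base → At* → Base
(B +axiom a) r = B r ⊎ (r ≡ ([] ⇒ a))

⊆B-+axiom : ∀ {B a} → B ⊆B (B +axiom a)
⊆B-+axiom r r∈B = inj₁ r∈B

axiom-derivable : ∀ {B a} → Derives (B +axiom a) [] a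
axiom-derivable {a = a} = app ([] ⇒ a) (inj₂ refl) []

mutual
  discharge-axiom : ∀ {B a Q b} → Derives (B +axiom a) Q b → Derives B (a ∷ Q) b
  discharge-axiom (ref b∈Q) = ref (there b∈Q)
  discharge-axiom (app r (inj₁ r∈B) ds) = app r r∈B (discharge-premises ds)
  discharge-axiom (app r (inj₂ refl) ds) = ref (here refl)

  discharge-premises : ∀ {B a Q ps} →
    Premises (B +axiom a) Q ps → Premises B (a ∷ Q) ps
  discharge-premises [] = []
  discharge-premises (d ∷ ds) = discharge-axiom d ∷ discharge-premises ds

J-elim : ∀ {U B} b → J U B → (U ⟶ ⟦ b ⟧) B → ⟦ b ⟧ B
J-elim {B = B} b j k = j b B ⊆B-refl k

J-unit : ∀ {U B} → UpClosed U → U B → J U B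
J-unit U↑ u b C s k = k C ⊆B-refl (U↑ s u)

J⟦⟧⇒⟦⟧ : ∀ {B} a → J ⟦ a ⟧ B → ⟦ a ⟧ B
J⟦⟧⇒⟦⟧ a j = J-elim a j (λ _ _ x → x)

⟦⟧⇒J⟦⟧ : ∀ {B} a → ⟦ a ⟧ B → J ⟦ a ⟧ B
⟦⟧⇒J⟦⟧ a = J-unit (⟦⟧-upClosed a)

J⟦⟧⇔⟦⟧ : ∀ {B} a → J ⟦ a ⟧ B ⇔ ⟦ a ⟧ B
J⟦⟧⇔⟦⟧ a = mk⇔ (J⟦⟧⇒⟦⟧ a) (⟦⟧⇒J⟦⟧ a)

rule-𝒩 : ∀ {B Q r} → 𝒩 ⊆B B → 𝒩 r →
         Premises B Q (premises r) → Derives B Q (conclusion r)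
rule-𝒩 N r∈𝒩 ds = app _ (N _ r∈𝒩) ds

mutual
  ♭⇒⟦⟧J : ∀ {B} → 𝒩 ⊆B B → (φ : Prop) → ⟦ φ ♭ ⟧ B → ⟦ ι φ ⟧J B
  ♭⇒⟦⟧J N (atom a) = ⟦⟧⇒J⟦⟧ (atom a ♭)
  ♭⇒⟦⟧J N ⊤' _ = _
  ♭⇒⟦⟧J N ⊥' (lift d) b C s k =
    lift (rule-𝒩 (⊆B-trans N s) (⊥E (unflat b)) (derives-mono s d ∷ []))
  ♭⇒⟦⟧J N (φ ∧' ψ) (lift d) =
    ♭⇒⟦⟧J N φ (lift (rule-𝒩 N (∧E₁ φ ψ) (d ∷ []))) ,
    ♭⇒⟦⟧J N ψ (lift (rule-𝒩 N (∧E₂ φ ψ) (d ∷ [])))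
  ♭⇒⟦⟧J N (φ ∨' ψ) (lift d) b C s k =
    lift (rule-𝒩 NC (∨E φ ψ (unflat b))
      ( derives-mono s d
      ∷ assume NC φ (λ D t x → k D t (inj₁ x))
      ∷ assume NC ψ (λ D t y → k D t (inj₂ y))
      ∷ []))
    where NC = ⊆B-trans N s
  ♭⇒⟦⟧J N (φ ⊃' ψ) (lift d) C s x =
    ♭⇒⟦⟧J NC ψ (lift (rule-𝒩 NC (⊃E φ ψ)
      (derives-mono s d ∷ lower (⟦⟧J⇒♭ NC φ x) ∷ [])))
    where NC = ⊆B-trans N s

  ⟦⟧J⇒♭ : ∀ {B} → 𝒩 ⊆B B → (φ : Prop) → ⟦ ι φ ⟧J B → ⟦ φ ♭ ⟧ B
  ⟦⟧J⇒♭ N (atom a) = J⟦⟧⇒⟦⟧ (atom a ♭)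
  ⟦⟧J⇒♭ N ⊤' _ = lift (rule-𝒩 N ⊤I [])
  ⟦⟧J⇒♭ N ⊥' j = J-elim (⊥' ♭) j (λ _ _ ())
  ⟦⟧J⇒♭ N (φ ∧' ψ) (x , y) =
    lift (rule-𝒩 N (∧I φ ψ) (lower (⟦⟧J⇒♭ N φ x) ∷ lower (⟦⟧J⇒♭ N ψ y) ∷ []))
  ⟦⟧J⇒♭ {B} N (φ ∨' ψ) j = J-elim ((φ ∨' ψ) ♭) j ∨-intro
    where
    ∨-intro : ((⟦ ι φ ⟧J ∪ ⟦ ι ψ ⟧J) ⟶ ⟦ (φ ∨' ψ) ♭ ⟧) B
    ∨-intro C s (inj₁ x) = lift (rule-𝒩 NC (∨I₁ φ ψ) (lower (⟦⟧J⇒♭ NC φ x) ∷ []))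
      where NC = ⊆B-trans N s
    ∨-intro C s (inj₂ y) = lift (rule-𝒩 NC (∨I₂ φ ψ) (lower (⟦⟧J⇒♭ NC ψ y) ∷ []))
      where NC = ⊆B-trans N s
  ⟦⟧J⇒♭ N (φ ⊃' ψ) f =
    lift (rule-𝒩 N (⊃I φ ψ)
      (assume N φ (λ C s x → ⟦⟧J⇒♭ (⊆B-trans N s) ψ (f C s x)) ∷ []))

  assume : ∀ {C b} → 𝒩 ⊆B C → (φ : Prop) →
           (⟦ ι φ ⟧J ⟶ ⟦ b ⟧) C → Derives C (φ ♭ ∷ []) b
  assume N φ k =
    discharge-axiom (lower (k _ ⊆B-+axiom (♭⇒⟦⟧J N+ φ (lift axiom-derivable))))
    where N+ = ⊆B-trans N ⊆B-+axiom

proposition14 : (B : Base) → 𝒩 ⊆B B → (φ : Prop) →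
    (⟦ φ ♭ ⟧ B ⇔ ⟦ ι φ ⟧J B) × (⟦ atom (φ ♭) ⟧J B ⇔ ⟦ ι φ ⟧J B)
proposition14 B N φ = ♭⇔⟦⟧J , ♭⇔⟦⟧J ⇔-∘ J⟦⟧⇔⟦⟧ (φ ♭)
  where ♭⇔⟦⟧J = mk⇔ (♭⇒⟦⟧J N φ) (⟦⟧J⇒♭ N φ)
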